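{- Let $A \xleftarrow{f} S \xrightarrow{g} B$ be a span diagram with pushout $(\mathrm{inl},\mathrm{inr},\mathrm{glue})$ on $A\sqcup_S B$, and let $a_0 : A$. Let $(P_A,P_B,P_S)$ be descent data over this span which is an identity system at a point $p_0 : P_A(a_0)$. Then the type of quadruples $(e_A,e_B,e_S,\omega)$ consisting of \begin{itemize} \item a family of equivalences $e_A\{a : A\} : (\mathrm{inl}(a_0) = \mathrm{inl}(a)) \simeq P_A(a)$, \item a family of equivalences $e_B\{b : B\} : (\mathrm{inl}(a_0) = \mathrm{inr}(b)) \simeq P_B(b)$, \item a family of identifications $e_S\{s : S\}(p : \mathrm{inl}(a_0) = \mathrm{inl}(f s)) : e_B(p \cdot \mathrm{glue}(s)) = P_S(e_A(p))$, \item an identification $\omega : e_A(\mathrm{refl}_{\mathrm{inl}(a_0)}) = p_0$, \end{itemize} is contractible; in particular such a quadruple exists and is unique.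
   Context: We work in homotopy type theory with univalent universes $\mathcal{U}$ and function extensionality, without assuming higher inductive types with judgmental computation rules. Paths are concatenated in diagrammatic order $p\cdot q$, $p^{ -1}$ is the inverse, $p_\#$ is transport, $\mathrm{ap}$ and $\mathrm{apd}$ are the actions of (dependent) functions on paths. A cocone on a type $X$ under a span $A \xleftarrow{f} S \xrightarrow{g} B$ is a triple $(i,j,K)$ with $i : A\to X$, $j : B\to X$, $K : i\circ f \sim j\circ g$. A pushout is a cocone $(\mathrm{inl},\mathrm{inr},\mathrm{glue})$ on a type $A\sqcup_S B$ such that for every type $Y$ the map $(A\sqcup_S B\to Y)\to \mathrm{cocone}(Y)$, $h\mapsto (h\circ\mathrm{inl}, h\circ\mathrm{inr}, s\mapsto \mathrm{ap}_h(\mathrm{glue}(s)))$, is an equivalence. Descent data over the span is a triple $(P_A,P_B,P_S)$ with $P_A : A\to\mathcal{U}$, $P_B : B\to\mathcal{U}$ and a family of equivalences $P_S\{s:S\} : P_A(f s)\simeq P_B(g s)$. A section of descent data $(P_A,P_B,P_S)$ is a triple $(t_A,t_B,t_S)$ with $t_A : (a:A)\to P_A(a)$, $t_B : (b:B)\to P_B(b)$ and $t_S(s) : P_S(t_A(f s)) = t_B(g s)$ for all $s:S$. The total span of $(P_A,P_B,P_S)$ is $\Sigma(a:A).P_A(a) \leftarrow \Sigma(s:S).P_A(fs) \rightarrow \Sigma(b:B).P_B(b)$ with maps $(s,p)\mapsto (fs,p)$ and $(s,p)\mapsto (gs,P_S(p))$. Given $a_0:A$ and $p_0 : P_A(a_0)$,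 the descent data $(P_A,P_B,P_S)$ is an identity system at $p_0$ if for all descent data $(Q_{\Sigma A},Q_{\Sigma B},Q_{\Sigma S})$ over the total span (so $Q_{\Sigma A}$ is a family over $\Sigma(a:A).P_A(a)$, $Q_{\Sigma B}$ over $\Sigma(b:B).P_B(b)$, and $Q_{\Sigma S}\{s,p\} : Q_{\Sigma A}(fs,p)\simeq Q_{\Sigma B}(gs,P_S(p))$), the evaluation map sending a section $(t_A,t_B,t_S)$ of $(Q_{\Sigma A},Q_{\Sigma B},Q_{\Sigma S})$ to $t_A(a_0,p_0) : Q_{\Sigma A}(a_0,p_0)$ has a section, i.e. there is a map $\mathrm{ind}$ in the other direction with $\mathrm{ev}\circ\mathrm{ind}\sim\mathrm{id}$. -}

{-# OPTIONS --without-K #-}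
module Defs where

open import Level using (Level; _⊔_; Setω)
open import Data.Product using (Σ; _,_; proj₁; proj₂)
open import Relation.Binary.PropositionalEquality using (_≡_; refl; trans; cong)

-- Basic HoTT notions (book-HoTT conventions).
-- Path concatenation p · q is  trans p q  (diagrammatic order), ap is cong.

isContr : ∀ {i} → Set i → Set i
isContr A = Σ A (λ c → (x : A) → c ≡ x)

fiber : ∀ {i j} {A : Set i} {B : Set j} → (A → B) → B → Set (i ⊔ j)
fiber {A = A} f y = Σ A (λ x → f x ≡ y)

isEquiv : ∀ {i j} {A : Set i} {B : Set j} → (A → B) → Set (i ⊔ j)
isEquiv {B = B} f = (y : B) → isContr (fiber f y)

_≃_ : ∀ {i j} → Set i → Set j → Set (i ⊔ j)
A ≃ B = Σ (A → B) isEquiv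

⟦_⟧ : ∀ {i j} {A : Set i} {B : Set j} → A ≃ B → A → B
⟦ e ⟧ = proj₁ e

idIsEquiv : ∀ {i} {A : Set i} → isEquiv (λ (x : A) → x)
idIsEquiv y = (y , refl) , λ { (x , refl) → refl }

idEquiv : ∀ {i} {A : Set i} → A ≃ A
idEquiv = (λ x → x) , idIsEquiv

happly : ∀ {i j} {A : Set i} {B : A → Set j} {f g : (x : A) → B x}
       → f ≡ g → (x : A) → f x ≡ g x
happly refl x = refl

idtoeqv : ∀ {i} {A B : Set i} → A ≡ B → A ≃ B
idtoeqv refl = idEquiv

FunExt : Setω
FunExt = ∀ {i j} {A : Set i} {B : A → Set j} (f g : (x : A) → B x)
       → isEquiv (happly {f = f} {g = g})

Univalence : Setω
Univalence = ∀ {i} (A B : Set i) → isEquiv (idtoeqv {A = A} {B = B})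

record Span (a s b : Level) : Set (Level.suc (a ⊔ s ⊔ b)) where
  field
    A : Set a
    S : Set s
    B : Set b
    f : S → A
    g : S → B

module _ {a s b : Level} (Sp : Span a s b) where
  open Span Sp

  record Cocone {x : Level} (X : Set x) : Set (a ⊔ s ⊔ b ⊔ x) where
    constructor cocone
    field
      i : A → X
      j : B → X
      K : (t : S) → i (f t) ≡ j (g t)

  cocone-map : ∀ {x y} {X : Set x} → Cocone X → (Y : Set y) → (X → Y) → Cocone Y
  cocone-map c Y h =
    cocone (λ t → h (Cocone.i c t)) (λ t → h (Cocone.j c t)) (λ t → cong h (Cocone.K c t))

  IsPushout : ∀ {x} {X : Set x} → Cocone X → Setω
  IsPushout c = ∀ {y} (Y : Set y) → isEquiv (cocone-map c Y)

  record Descent (p : Level) : Set (a ⊔ s ⊔ b ⊔ Level.suc p) where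
    field
      PA : A → Set p
      PB : B → Set p
      PS : (t : S) → PA (f t) ≃ PB (g t)

  record Section {p : Level} (P : Descent p) : Set (a ⊔ s ⊔ b ⊔ p) where
    constructor section
    open Descent P
    field
      tA : (x : A) → PA x
      tB : (y : B) → PB y
      tS : (t : S) → ⟦ PS t ⟧ (tA (f t)) ≡ tB (g t)

  totalSpan : ∀ {p} → Descent p → Span (a ⊔ p) (s ⊔ p) (b ⊔ p)
  totalSpan P = record
    { A = Σ A PA
    ; S = Σ S (λ t → PA (f t))
    ; B = Σ B PB
    ; f = λ { (t , u) → (f t , u) }
    ; g = λ { (t , u) → (g t , ⟦ PS t ⟧ u) }
    }
    where open Descent P

  Quadruples : ∀ {x p} {X : Set x} (c : Cocone X) (a0 : A) (P : Descent p)
             (p0 : Descent.PA P a0) → Set (a ⊔ s ⊔ b ⊔ x ⊔ p)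
  Quadruples c a0 P p0 =
    Σ ((x : A) → (inl a0 ≡ inl x) ≃ PA x) λ eA →
    Σ ((y : B) → (inl a0 ≡ inr y) ≃ PB y) λ eB →
    Σ ((t : S) (q : inl a0 ≡ inl (f t)) →
         ⟦ eB (g t) ⟧ (trans q (glue t)) ≡ ⟦ PS t ⟧ (⟦ eA (f t) ⟧ q)) λ eS →
    ⟦ eA a0 ⟧ refl ≡ p0
    where
      open Descent P
      inl = Cocone.i c
      inr = Cocone.j c
      glue = Cocone.K c

IsIdentitySystem : ∀ {a s b p} (Sp : Span a s b) (P : Descent Sp p)
                 (a0 : Span.A Sp) (p0 : Descent.PA P a0) → Setω
IsIdentitySystem Sp P a0 p0 =
  ∀ {q} (Q : Descent (totalSpan Sp P) q) →
    Σ (Descent.PA Q (a0 , p0) → Section (totalSpan Sp P) Q)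
      (λ ind → (u : Descent.PA Q (a0 , p0)) → Section.tA (ind u) (a0 , p0) ≡ u)

{-# OPTIONS --without-K #-}
-- By univalence and the universal property of the pushout, P is the descent data of a type family
-- P̃ over the pushout (transport along glue), so we may assume P = familyDescent P̃. Applying the
-- identity-system hypothesis to the descent data of paths out of (inl a₀ , p₀) and eliminating out
-- of the pushout shows that Σ X P̃ is contractible; hence transport of p₀ is a family of
-- equivalences enc : (inl a₀ ≡ z) ≃ P̃ z. The hypothesis also makes pointed sections of any
-- descent data over the total span contractible, since two of them are joined by a section of the
-- descent data of paths between them. Quadruples are a retract of the pointed endomorphisms of P
-- (precompose with enc one way, with its inverse the other), hence contractible.
module Submission where

open import Level using (Level; _⊔_; Setω)
open import Function.Base using (id; _∘_)
open import Function.Bundles using (Inverse)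
open import Data.Product using (Σ; _,_; proj₁; proj₂)
open import Data.Product.Properties using (Σ-≡,≡→≡; Σ-≡,≡←≡; Σ-≡,≡↔≡)
open import Relation.Binary.PropositionalEquality
  using (_≡_; refl; trans; sym; cong; cong₂; subst; module ≡-Reasoning)
open import Relation.Binary.PropositionalEquality.Properties
  using (trans-reflʳ; trans-assoc; trans-symˡ; cong-id; cong-∘; subst-subst)
open import Defs

private
  variable
    ℓ ℓ₁ ℓ₂ ℓ₃ ℓ₄ : Level
    U : Set ℓ₁
    V : Set ℓ₂

sym-trans≡refl⇒≡ : {x y : U} {p q : x ≡ y} → trans (sym p) q ≡ refl → p ≡ q
sym-trans≡refl⇒≡ {p = refl} h = sym h

refl≡trans-sym⇒≡ : {x y : U} {p q : x ≡ y} → refl ≡ trans p (sym q) → p ≡ q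
refl≡trans-sym⇒≡ {p = p} {q = refl} h = trans (sym (trans-reflʳ p)) (sym h)

cong-trans-reflʳ : {x : U} {d : x ≡ x} (α : d ≡ refl) →
                   trans (sym (trans-reflʳ d)) (cong (λ γ → trans γ refl) α) ≡ α
cong-trans-reflʳ refl = refl

cong-proj₁-Σ-≡,≡→≡ : {P : U → Set ℓ} {x y : U} {u : P x} {v : P y}
                     (p : x ≡ y) (q : subst P p u ≡ v) → cong proj₁ (Σ-≡,≡→≡ (p , q)) ≡ p
cong-proj₁-Σ-≡,≡→≡ refl refl = refl

-- Naturality of the homotopy e along h, with the endpoint E (k d) moved along n and s.
naturality-conjugate : {Y : Set ℓ₃} {Z : Set ℓ₄} {W : Set ℓ}
                       (E : V → W) (F : Z → W) (G : Y → Z) (k : Y → V)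
                       (e : ∀ y → E (k y) ≡ F (G y)) {d q : Y} {v₀ v₁ : V}
                       (s : v₀ ≡ v₁) (n : k d ≡ v₁) (h : d ≡ q) →
                       trans (trans (cong E s) (sym (trans (sym (e d)) (cong E n)))) (cong F (cong G h))
                         ≡ trans (cong E (trans s (trans (sym n) (cong k h)))) (e q)
naturality-conjugate E F G k e refl refl refl = cancel (e _)
  where
  cancel : {w₁ w₂ : U} (r : w₁ ≡ w₂) → trans (sym (trans (sym r) refl)) refl ≡ r
  cancel refl = refl

isContr⇒≡ : isContr U → (x y : U) → x ≡ y
isContr⇒≡ (c , h) x y = trans (sym (h x)) (h y)

isContr-≡ : isContr U → (x y : U) → isContr (x ≡ y)
isContr-≡ (c , h) x y = isContr⇒≡ (c , h) x y , canonical
  where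
  canonical : ∀ {y} (p : x ≡ y) → isContr⇒≡ (c , h) x y ≡ p
  canonical refl = trans-symˡ (h x)

isContr-retract : isContr V → (s : U → V) (r : V → U) → (∀ x → r (s x) ≡ x) → isContr U
isContr-retract (c , h) s r rs = r c , λ x → trans (cong r (h (s x))) (rs x)

isContr-Σ⇒subst-isEquiv : {P : U → Set ℓ} {x₀ : U} (p₀ : P x₀) → isContr (Σ U P) →
                           (x : U) → isEquiv (λ (q : x₀ ≡ x) → subst P q p₀)
isContr-Σ⇒subst-isEquiv p₀ contr x p =
  isContr-retract (isContr-≡ contr (_ , p₀) (x , p)) Σ-≡,≡→≡ Σ-≡,≡←≡
                  (Inverse.strictlyInverseʳ Σ-≡,≡↔≡)

isEquiv-inverse : {F : U → V} → isEquiv F → V → U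
isEquiv-inverse e y = proj₁ (proj₁ (e y))

isEquiv-retraction : {F : U → V} (e : isEquiv F) (x : U) → isEquiv-inverse e (F x) ≡ x
isEquiv-retraction {F = F} e x = cong proj₁ (isContr⇒≡ (e (F x)) (proj₁ (e (F x))) (x , refl))

isEquiv⇒injective : {F : U → V} → isEquiv F → {x y : U} → F x ≡ F y → x ≡ y
isEquiv⇒injective e {x} {y} p = cong proj₁ (isContr⇒≡ (e _) (x , p) (y , refl))

isEquiv-∼ : {F G : U → V} → isEquiv F → (∀ x → F x ≡ G x) → isEquiv G
isEquiv-∼ {F = F} {G} e H y = isContr-retract (e y) toF toG toG∘toF
  where
  toF : fiber G y → fiber F y
  toF (x , p) = x , trans (H x) p
  toG : fiber F y → fiber G y
  toG (x , p) = x , trans (sym (H x)) p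
  toG∘toF : ∀ w → toG (toF w) ≡ w
  toG∘toF (x , p) =
    cong (x ,_) (trans (sym (trans-assoc (sym (H x)))) (cong (λ γ → trans γ p) (trans-symˡ (H x))))

subst-isEquiv : (P : U → Set ℓ) {x y : U} (r : x ≡ y) → isEquiv (subst P r)
subst-isEquiv P refl = idIsEquiv

trans-isEquiv : {x y z : U} (r : y ≡ z) → isEquiv (λ (q : x ≡ y) → trans q r)
trans-isEquiv refl = isEquiv-∼ idIsEquiv (λ q → sym (trans-reflʳ q))

fiber-cong→≡ : {F : U → V} {x y : U} {π : F x ≡ F y} →
               fiber (cong F) π → _≡_ {A = fiber F (F y)} (x , π) (y , refl)
fiber-cong→≡ (refl , refl) = refl

≡→fiber-cong : {F : U → V} {x y : U} {π : F x ≡ F y} →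
               _≡_ {A = fiber F (F y)} (x , π) (y , refl) → fiber (cong F) π
≡→fiber-cong refl = refl , refl

≡→fiber-cong∘fiber-cong→≡ : {F : U → V} {x y : U} {π : F x ≡ F y} (w : fiber (cong F) π) →
                             ≡→fiber-cong (fiber-cong→≡ w) ≡ w
≡→fiber-cong∘fiber-cong→≡ (refl , refl) = refl

cong-isEquiv : (F : U → V) → isEquiv F → {x y : U} → isEquiv (cong F {x} {y})
cong-isEquiv F e {x} {y} π =
  isContr-retract (isContr-≡ (e (F y)) (x , π) (y , refl))
                  fiber-cong→≡ ≡→fiber-cong ≡→fiber-cong∘fiber-cong→≡

conjugate-isEquiv : (F : U → V) → isEquiv F → {x₁ x₂ : U} {y₁ y₂ : V}
                    (s₁ : F x₁ ≡ y₁) (s₂ : F x₂ ≡ y₂) →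
                    isEquiv (λ (π : x₁ ≡ x₂) → trans (sym s₁) (trans (cong F π) s₂))
conjugate-isEquiv F e refl refl = isEquiv-∼ (cong-isEquiv F e) (λ π → sym (trans-reflʳ _))

module _ (fe : FunExt) where

  funext : {P : U → Set ℓ} {φ ψ : (x : U) → P x} → (∀ x → φ x ≡ ψ x) → φ ≡ ψ
  funext {φ = φ} {ψ} H = proj₁ (proj₁ (fe φ ψ H))

  happly-funext : {P : U → Set ℓ} {φ ψ : (x : U) → P x} (H : ∀ x → φ x ≡ ψ x) →
                  happly (funext H) ≡ H
  happly-funext {φ = φ} {ψ} H = proj₂ (proj₁ (fe φ ψ H))

  ∼-J : {P : U → Set ℓ} {φ : (x : U) → P x}
        (M : (ψ : (x : U) → P x) → (∀ x → φ x ≡ ψ x) → Set ℓ₃) → M φ (λ _ → refl) →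
        ∀ {ψ} (H : ∀ x → φ x ≡ ψ x) → M ψ H
  ∼-J {φ = φ} M m H = subst (M _) (happly-funext H) (J (funext H))
    where
    J : ∀ {ψ} (p : φ ≡ ψ) → M ψ (happly p)
    J refl = m

  ∼₂-J : {P : U → Set ℓ} {C : (x : U) → P x → Set ℓ₃} {φ : (x : U) (y : P x) → C x y}
         (M : (ψ : (x : U) (y : P x) → C x y) → (∀ x y → φ x y ≡ ψ x y) → Set ℓ₄) →
         M φ (λ _ _ → refl) → ∀ {ψ} (H : ∀ x y → φ x y ≡ ψ x y) → M ψ H
  ∼₂-J M m H =
    subst (M _) (funext λ x → happly-funext (H x))
          (∼-J (λ ψ K → M ψ (λ x → happly (K x))) m (λ x → funext (H x)))

  isContr-isProp : (c₁ c₂ : isContr U) → c₁ ≡ c₂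
  isContr-isProp (c , h) (d , k) =
    Σ-≡,≡→≡ (h d , funext λ z → isContr⇒≡ (isContr-≡ (c , h) d z) _ _)

  isEquiv-isProp : {F : U → V} (e₁ e₂ : isEquiv F) → e₁ ≡ e₂
  isEquiv-isProp e₁ e₂ = funext λ y → isContr-isProp (e₁ y) (e₂ y)

-- IsIdentitySystem Sp P a₀ p₀ is by definition HasPointedInduction (totalSpan Sp P) (a₀ , p₀).
HasPointedInduction : ∀ {a s b} (T : Span a s b) → Span.A T → Setω
HasPointedInduction T x₀ =
  ∀ {q} (Q : Descent T q) →
    Σ (Descent.PA Q x₀ → Section T Q) (λ ind → (u : Descent.PA Q x₀) → Section.tA (ind u) x₀ ≡ u)

module _ {a s b : Level} (T : Span a s b) where
  open Span T

  module _ {q : Level} (Q : Descent T q) where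
    open Descent Q

    PointedSection : (x₀ : A) → PA x₀ → Set (a ⊔ s ⊔ b ⊔ q)
    PointedSection x₀ q₀ = Σ (Section T Q) (λ σ → Section.tA σ x₀ ≡ q₀)

    sectionPaths : Section T Q → Section T Q → Descent T q
    sectionPaths (section tA tB tS) (section tA' tB' tS') = record
      { PA = λ x → tA x ≡ tA' x
      ; PB = λ y → tB y ≡ tB' y
      ; PS = λ t → (λ π → trans (sym (tS t)) (trans (cong ⟦ PS t ⟧ π) (tS' t)))
                 , conjugate-isEquiv ⟦ PS t ⟧ (proj₂ (PS t)) (tS t) (tS' t)
      }

    PointedSection-≡ : FunExt → {x₀ : A} {q₀ : PA x₀} (m m' : PointedSection x₀ q₀) →
                       (H : Section T (sectionPaths (proj₁ m) (proj₁ m'))) →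
                       Section.tA H x₀ ≡ trans (proj₂ m) (sym (proj₂ m')) → m ≡ m'
    PointedSection-≡ fe {x₀} {q₀} (section tA tB tS , ε) _ (section hA hB hS) =
      ∼-J fe (λ tA' hA → ∀ {tB'} (hB : ∀ y → tB y ≡ tB' y)
                {tS' : SectionSquare tA' tB'} {ε' : tA' x₀ ≡ q₀} →
                (∀ t → trans (sym (tS t)) (trans (cong ⟦ PS t ⟧ (hA (f t))) (tS' t)) ≡ hB (g t)) →
                hA x₀ ≡ trans ε (sym ε') →
                _≡_ {A = PointedSection x₀ q₀} (section tA tB tS , ε) (section tA' tB' tS' , ε'))
        (∼-J fe (λ tB' hB → ∀ {tS' : SectionSquare tA tB'} {ε' : tA x₀ ≡ q₀} →
                   (∀ t → trans (sym (tS t)) (tS' t) ≡ hB (g t)) →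
                   refl ≡ trans ε (sym ε') →
                   _≡_ {A = PointedSection x₀ q₀} (section tA tB tS , ε) (section tA tB' tS' , ε'))
           λ hS hε → cong₂ (λ tS' ε' → section tA tB tS' , ε')
                           (funext fe λ t → sym-trans≡refl⇒≡ (hS t)) (refl≡trans-sym⇒≡ hε))
        hA hB hS
      where
      SectionSquare : ((x : A) → PA x) → ((y : B) → PB y) → Set _
      SectionSquare tA' tB' = (t : S) → ⟦ PS t ⟧ (tA' (f t)) ≡ tB' (g t)

  isContr-PointedSection : FunExt → {x₀ : A} → HasPointedInduction T x₀ →
                           ∀ {q} (Q : Descent T q) (q₀ : Descent.PA Q x₀) →
                           isContr (PointedSection Q x₀ q₀)
  isContr-PointedSection fe ind Q q₀ = centre , λ m →
    PointedSection-≡ Q fe centre m (proj₁ (ind (paths m)) _) (proj₂ (ind (paths m)) _)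
    where
    centre : PointedSection Q _ q₀
    centre = proj₁ (ind Q) q₀ , proj₂ (ind Q) q₀
    paths : PointedSection Q _ q₀ → Descent T _
    paths m = sectionPaths Q (proj₁ centre) (proj₁ m)

module _ {a s b p : Level} {Sp : Span a s b} (P : Descent Sp p) where
  open Descent P

  -- Its sections are the endomorphisms of P.
  endoDescent : Descent (totalSpan Sp P) p
  endoDescent = record { PA = PA ∘ proj₁ ; PB = PB ∘ proj₁ ; PS = PS ∘ proj₁ }

  idSection : Section (totalSpan Sp P) endoDescent
  idSection = section proj₂ proj₂ (λ _ → refl)

module _ (fe : FunExt) {a s b : Level} {Sp : Span a s b} where

  cocone-map-id : {X : Set ℓ} (d : Cocone Sp X) → cocone-map Sp d X id ≡ d
  cocone-map-id (cocone i j K) = cong (cocone i j) (funext fe λ t → cong-id (K t))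

  cocone-map-∘ : {X : Set ℓ₁} {Y : Set ℓ₂} {Z : Set ℓ₃} (d : Cocone Sp X) (k : X → Y) (h : Y → Z) →
                 cocone-map Sp (cocone-map Sp d Y k) Z h ≡ cocone-map Sp d Z (h ∘ k)
  cocone-map-∘ (cocone i j K) k h = cong (cocone _ _) (funext fe λ t → sym (cong-∘ (K t)))

module _ {a s b x : Level} {Sp : Span a s b} {X : Set x} (c : Cocone Sp X) where
  open Span Sp
  open Cocone c renaming (i to inl; j to inr; K to glue)

  -- No computation rule is derived, and none is needed.
  pushout-elim : FunExt → IsPushout Sp c → (F : X → Set ℓ)
                 (dA : ∀ a → F (inl a)) (dB : ∀ b → F (inr b)) →
                 (∀ t → subst F (glue t) (dA (f t)) ≡ dB (g t)) → ∀ z → F z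
  pushout-elim fe up F dA dB dS z = subst F (happly proj₁∘k≡id z) (proj₂ (k z))
    where
    totalCocone : Cocone Sp (Σ X F)
    totalCocone = cocone (λ a → inl a , dA a) (λ b → inr b , dB b)
                         (λ t → Σ-≡,≡→≡ (glue t , dS t))
    k : X → Σ X F
    k = proj₁ (proj₁ (up (Σ X F) totalCocone))
    k-cocone : cocone-map Sp c (Σ X F) k ≡ totalCocone
    k-cocone = proj₂ (proj₁ (up (Σ X F) totalCocone))
    proj₁-totalCocone : cocone-map Sp totalCocone X proj₁ ≡ c
    proj₁-totalCocone =
      cong (cocone inl inr) (funext fe λ t → cong-proj₁-Σ-≡,≡→≡ (glue t) (dS t))
    proj₁∘k≡id : proj₁ ∘ k ≡ id
    proj₁∘k≡id = isEquiv⇒injective (up X) (begin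
        cocone-map Sp c X (proj₁ ∘ k)          ≡⟨ sym (cocone-map-∘ fe c k proj₁) ⟩
        cocone-map Sp (cocone-map Sp c (Σ X F) k) X proj₁
                                               ≡⟨ cong (λ d → cocone-map Sp d X proj₁) k-cocone ⟩
        cocone-map Sp totalCocone X proj₁      ≡⟨ proj₁-totalCocone ⟩
        c                                      ≡⟨ sym (cocone-map-id fe c) ⟩
        cocone-map Sp c X id                   ∎)
      where open ≡-Reasoning

  familyDescent : ∀ {p} → (X → Set p) → Descent Sp p
  familyDescent P̃ = record
    { PA = P̃ ∘ inl
    ; PB = P̃ ∘ inr
    ; PS = λ t → subst P̃ (glue t) , subst-isEquiv P̃ (glue t)
    }

  coconeDescent : ∀ {p} → Cocone Sp (Set p) → Descent Sp p
  coconeDescent (cocone PA PB PS) = record { PA = PA ; PB = PB ; PS = λ t → idtoeqv (PS t) }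

  idtoeqv-cong : ∀ {p} (P̃ : X → Set p) {u v : X} (r : u ≡ v) →
                 idtoeqv (cong P̃ r) ≡ (subst P̃ r , subst-isEquiv P̃ r)
  idtoeqv-cong P̃ refl = refl

  familyDescent-surjective : FunExt → Univalence → IsPushout Sp c →
                             ∀ {p} (P : Descent Sp p) → Σ (X → Set p) (λ P̃ → familyDescent P̃ ≡ P)
  familyDescent-surjective fe univ up {p} P = P̃ , (begin
      familyDescent P̃                           ≡⟨ cong-PS (funext fe λ t → sym (idtoeqv-cong P̃ (glue t))) ⟩
      coconeDescent (cocone-map Sp c (Set p) P̃) ≡⟨ cong coconeDescent P̃-cocone ⟩
      coconeDescent Pcocone                      ≡⟨ cong-PS (funext fe λ t → ua-β (PS t)) ⟩
      P                                          ∎)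
    where
    open Descent P
    open ≡-Reasoning
    ua : {Y Z : Set p} → Y ≃ Z → Y ≡ Z
    ua {Y} {Z} e = proj₁ (proj₁ (univ Y Z e))
    ua-β : {Y Z : Set p} (e : Y ≃ Z) → idtoeqv (ua e) ≡ e
    ua-β {Y} {Z} e = proj₂ (proj₁ (univ Y Z e))
    Pcocone : Cocone Sp (Set p)
    Pcocone = cocone PA PB (λ t → ua (PS t))
    P̃ : X → Set p
    P̃ = proj₁ (proj₁ (up (Set p) Pcocone))
    P̃-cocone : cocone-map Sp c (Set p) P̃ ≡ Pcocone
    P̃-cocone = proj₂ (proj₁ (up (Set p) Pcocone))
    cong-PS : {QA : A → Set p} {QB : B → Set p} {e₁ e₂ : (t : S) → QA (f t) ≃ QB (g t)} → e₁ ≡ e₂ →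
              _≡_ {A = Descent Sp p} (record { PA = QA ; PB = QB ; PS = e₁ })
                                     (record { PA = QA ; PB = QB ; PS = e₂ })
    cong-PS = cong (λ e → record { PA = _ ; PB = _ ; PS = e })

  module _ (fe : FunExt) {p : Level} (a₀ : A) (P : Descent Sp p) (p₀ : Descent.PA P a₀) where
    open Descent P

    MapA : Set (a ⊔ x ⊔ p)
    MapA = (a : A) → inl a₀ ≡ inl a → PA a

    MapB : Set (b ⊔ x ⊔ p)
    MapB = (b : B) → inl a₀ ≡ inr b → PB b

    GlueSquare : MapA → MapB → Set (s ⊔ x ⊔ p)
    GlueSquare mA mB =
      (t : S) (q : inl a₀ ≡ inl (f t)) → mB (g t) (trans q (glue t)) ≡ ⟦ PS t ⟧ (mA (f t) q)

    mkQuadruple : (mA : MapA) (mB : MapB) → (∀ a → isEquiv (mA a)) → (∀ b → isEquiv (mB b)) →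
                  GlueSquare mA mB → mA a₀ refl ≡ p₀ → Quadruples Sp c a₀ P p₀
    mkQuadruple mA mB iA iB eS ω = (λ a → mA a , iA a) , (λ b → mB b , iB b) , eS , ω

    Quadruple-≡ : {mA₁ mA₂ : MapA} {mB₁ mB₂ : MapB}
                  {iA₁ : ∀ a → isEquiv (mA₁ a)} {iA₂ : ∀ a → isEquiv (mA₂ a)}
                  {iB₁ : ∀ b → isEquiv (mB₁ b)} {iB₂ : ∀ b → isEquiv (mB₂ b)}
                  {eS₁ : GlueSquare mA₁ mB₁} {eS₂ : GlueSquare mA₂ mB₂}
                  {ω₁ : mA₁ a₀ refl ≡ p₀} {ω₂ : mA₂ a₀ refl ≡ p₀}
                  (HA : ∀ a q → mA₁ a q ≡ mA₂ a q) (HB : ∀ b q → mB₁ b q ≡ mB₂ b q) →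
                  (∀ t q → trans (eS₁ t q) (cong ⟦ PS t ⟧ (HA (f t) q))
                           ≡ trans (HB (g t) (trans q (glue t))) (eS₂ t q)) →
                  ω₁ ≡ trans (HA a₀ refl) ω₂ →
                  mkQuadruple mA₁ mB₁ iA₁ iB₁ eS₁ ω₁ ≡ mkQuadruple mA₂ mB₂ iA₂ iB₂ eS₂ ω₂
    Quadruple-≡ {mA₁} {mB₁ = mB₁} {iA₁ = iA₁} {iB₁ = iB₁} {eS₁ = eS₁} {ω₁ = ω₁} HA HB HS Hω =
      ∼₂-J fe (λ mA₂ HA → ∀ {mB₂} (HB : ∀ b q → mB₁ b q ≡ mB₂ b q)
                 {iA₂ : ∀ a → isEquiv (mA₂ a)} {iB₂ : ∀ b → isEquiv (mB₂ b)}
                 {eS₂ : GlueSquare mA₂ mB₂} {ω₂ : mA₂ a₀ refl ≡ p₀} →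
                 (∀ t q → trans (eS₁ t q) (cong ⟦ PS t ⟧ (HA (f t) q))
                          ≡ trans (HB (g t) (trans q (glue t))) (eS₂ t q)) →
                 ω₁ ≡ trans (HA a₀ refl) ω₂ →
                 mkQuadruple mA₁ mB₁ iA₁ iB₁ eS₁ ω₁ ≡ mkQuadruple mA₂ mB₂ iA₂ iB₂ eS₂ ω₂)
        (∼₂-J fe (λ mB₂ HB → {iA₂ : ∀ a → isEquiv (mA₁ a)} {iB₂ : ∀ b → isEquiv (mB₂ b)}
                    {eS₂ : GlueSquare mA₁ mB₂} {ω₂ : mA₁ a₀ refl ≡ p₀} →
                    (∀ t q → trans (eS₁ t q) refl ≡ trans (HB (g t) (trans q (glue t))) (eS₂ t q)) →
                    ω₁ ≡ ω₂ →
                    mkQuadruple mA₁ mB₁ iA₁ iB₁ eS₁ ω₁ ≡ mkQuadruple mA₁ mB₂ iA₂ iB₂ eS₂ ω₂)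
           λ {iA₂} {iB₂} hS hω →
             trans (cong₂ (λ iA iB → mkQuadruple mA₁ mB₁ iA iB eS₁ ω₁)
                          (funext fe λ a → isEquiv-isProp fe (iA₁ a) (iA₂ a))
                          (funext fe λ b → isEquiv-isProp fe (iB₁ b) (iB₂ b)))
                   (cong₂ (mkQuadruple mA₁ mB₁ iA₂ iB₂)
                          (funext fe λ t → funext fe λ q → trans (sym (trans-reflʳ _)) (hS t q))
                          hω))
        HA HB HS Hω

  module _ (fe : FunExt) (up : IsPushout Sp c) {p : Level} (P̃ : X → Set p) {a₀ : A} (p₀ : P̃ (inl a₀))
           (ind : IsIdentitySystem Sp (familyDescent P̃) a₀ p₀) where

    base : Σ X P̃
    base = inl a₀ , p₀

    pathsFromBase : Descent (totalSpan Sp (familyDescent P̃)) (x ⊔ p)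
    pathsFromBase = record
      { PA = λ (a , u) → base ≡ (inl a , u)
      ; PB = λ (b , v) → base ≡ (inr b , v)
      ; PS = λ (t , u) → (λ γ → trans γ (Σ-≡,≡→≡ (glue t , refl))) , trans-isEquiv _
      }

    subst-pathsFromBase : {u v : X} (r : u ≡ v)
                          {φ : ∀ y → base ≡ (u , y)} {ψ : ∀ y → base ≡ (v , y)} →
                          (∀ y → trans (φ y) (Σ-≡,≡→≡ (r , refl)) ≡ ψ (subst P̃ r y)) →
                          subst (λ z → ∀ y → base ≡ (z , y)) r φ ≡ ψ
    subst-pathsFromBase refl τ = funext fe λ y → trans (sym (trans-reflʳ _)) (τ y)

    isContr-Σ : isContr (Σ X P̃)
    isContr-Σ = base , λ (z , y) →
      pushout-elim fe up (λ z → ∀ y → base ≡ (z , y))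
        (λ a u → Section.tA σ (a , u)) (λ b v → Section.tB σ (b , v))
        (λ t → subst-pathsFromBase (glue t) (λ u → Section.tS σ (t , u))) z y
      where
      σ : Section (totalSpan Sp (familyDescent P̃)) pathsFromBase
      σ = proj₁ (ind pathsFromBase) refl

    enc : {z : X} → inl a₀ ≡ z → P̃ z
    enc q = subst P̃ q p₀

    enc-isEquiv : (z : X) → isEquiv (enc {z})
    enc-isEquiv = isContr-Σ⇒subst-isEquiv p₀ isContr-Σ

    dec : {z : X} → P̃ z → inl a₀ ≡ z
    dec {z} = isEquiv-inverse (enc-isEquiv z)

    dec-enc : {z : X} (q : inl a₀ ≡ z) → dec (enc q) ≡ q
    dec-enc {z} = isEquiv-retraction (enc-isEquiv z)

    dec-subst : {u v : X} (r : u ≡ v) (y : P̃ u) → trans (dec y) r ≡ dec (subst P̃ r y)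
    dec-subst refl y = trans-reflʳ (dec y)

    enc-trans : {u v : X} (q : inl a₀ ≡ u) (r : u ≡ v) → enc (trans q r) ≡ subst P̃ r (enc q)
    enc-trans q r = sym (subst-subst q)

    dec-enc-trans : {u v : X} (q : inl a₀ ≡ u) (r : u ≡ v) →
                    trans (cong dec (enc-trans q r))
                          (trans (sym (dec-subst r (enc q))) (cong (λ γ → trans γ r) (dec-enc q)))
                      ≡ dec-enc (trans q r)
    dec-enc-trans refl refl = cong-trans-reflʳ (dec-enc refl)

    PointedEndo : Set (a ⊔ s ⊔ b ⊔ p)
    PointedEndo =
      PointedSection (totalSpan Sp (familyDescent P̃)) (endoDescent (familyDescent P̃)) (a₀ , p₀) p₀

    isContr-PointedEndo : isContr PointedEndo
    isContr-PointedEndo = isContr-PointedSection _ fe ind _ p₀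

    idSection≡ : (m : PointedEndo) → (idSection (familyDescent P̃) , refl) ≡ m
    idSection≡ = isContr⇒≡ isContr-PointedEndo _

    toQuadruple : PointedEndo → Quadruples Sp c a₀ (familyDescent P̃) p₀
    -- m is the identity section up to a path, and at the identity section the maps are enc.
    toQuadruple m@(section tA tB tS , ε) =
        (λ a → (λ q → tA (a , enc q))
             , subst (λ m → isEquiv (λ q → Section.tA (proj₁ m) (a , enc q)))
                     (idSection≡ m) (enc-isEquiv (inl a)))
      , (λ b → (λ q → tB (b , enc q))
             , subst (λ m → isEquiv (λ q → Section.tB (proj₁ m) (b , enc q)))
                     (idSection≡ m) (enc-isEquiv (inr b)))
      , (λ t q → trans (cong (λ v → tB (g t , v)) (enc-trans q (glue t))) (sym (tS (t , enc q))))
      , ε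

    fromQuadruple : Quadruples Sp c a₀ (familyDescent P̃) p₀ → PointedEndo
    fromQuadruple (eA , eB , eS , ω) =
        section (λ (a , u) → ⟦ eA a ⟧ (dec u))
                (λ (b , v) → ⟦ eB b ⟧ (dec v))
                (λ (t , u) → trans (sym (eS t (dec u))) (cong ⟦ eB (g t) ⟧ (dec-subst (glue t) u)))
      , trans (cong ⟦ eA a₀ ⟧ (dec-enc refl)) ω

    toQuadruple∘fromQuadruple : ∀ E → toQuadruple (fromQuadruple E) ≡ E
    toQuadruple∘fromQuadruple (eA , eB , eS , ω) =
      Quadruple-≡ fe a₀ (familyDescent P̃) p₀
        (λ a q → cong ⟦ eA a ⟧ (dec-enc q)) (λ b q → cong ⟦ eB b ⟧ (dec-enc q)) square refl
      where
      open ≡-Reasoning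
      square : (t : S) (q : inl a₀ ≡ inl (f t)) →
               trans (trans (cong (λ v → ⟦ eB (g t) ⟧ (dec v)) (enc-trans q (glue t)))
                            (sym (trans (sym (eS t (dec (enc q))))
                                        (cong ⟦ eB (g t) ⟧ (dec-subst (glue t) (enc q))))))
                     (cong (subst P̃ (glue t)) (cong ⟦ eA (f t) ⟧ (dec-enc q)))
                 ≡ trans (cong ⟦ eB (g t) ⟧ (dec-enc (trans q (glue t)))) (eS t q)
      square t q = begin
          trans (trans (cong (E ∘ dec) ρ) (sym (trans (sym (eS t _)) (cong E ν)))) (cong F (cong G η))
            ≡⟨ cong (λ γ → trans (trans γ (sym (trans (sym (eS t _)) (cong E ν)))) (cong F (cong G η)))
                    (cong-∘ ρ) ⟩
          trans (trans (cong E (cong dec ρ)) (sym (trans (sym (eS t _)) (cong E ν)))) (cong F (cong G η))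
            ≡⟨ naturality-conjugate E F G (λ γ → trans γ (glue t)) (eS t) (cong dec ρ) ν η ⟩
          trans (cong E (trans (cong dec ρ) (trans (sym ν) (cong (λ γ → trans γ (glue t)) η)))) (eS t q)
            ≡⟨ cong (λ γ → trans (cong E γ) (eS t q)) (dec-enc-trans q (glue t)) ⟩
          trans (cong E (dec-enc (trans q (glue t)))) (eS t q) ∎
        where
        E : inl a₀ ≡ inr (g t) → P̃ (inr (g t))
        E = ⟦ eB (g t) ⟧
        F : P̃ (inl (f t)) → P̃ (inr (g t))
        F = subst P̃ (glue t)
        G : inl a₀ ≡ inl (f t) → P̃ (inl (f t))
        G = ⟦ eA (f t) ⟧
        ρ : enc (trans q (glue t)) ≡ F (enc q)
        ρ = enc-trans q (glue t)
        ν : trans (dec (enc q)) (glue t) ≡ dec (F (enc q))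
        ν = dec-subst (glue t) (enc q)
        η : dec (enc q) ≡ q
        η = dec-enc q

    isContr-Quadruples : isContr (Quadruples Sp c a₀ (familyDescent P̃) p₀)
    isContr-Quadruples = isContr-retract isContr-PointedEndo fromQuadruple toQuadruple toQuadruple∘fromQuadruple

theorem3p8 : FunExt → Univalence →
    ∀ {a s b x p} (Sp : Span a s b) {X : Set x} (c : Cocone Sp X) →
    IsPushout Sp c →
    (a0 : Span.A Sp) (P : Descent Sp p) (p0 : Descent.PA P a0) →
    IsIdentitySystem Sp P a0 p0 →
    isContr (Quadruples Sp c a0 P p0)
theorem3p8 fe univ {p = p} Sp {X} c up a0 P p0 =
  fromFamily (proj₂ (familyDescent-surjective c fe univ up P)) p0
  where
  fromFamily : {P̃ : X → Set p} {P : Descent Sp p} → familyDescent c P̃ ≡ P → (p0 : Descent.PA P a0) →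
          IsIdentitySystem Sp P a0 p0 → isContr (Quadruples Sp c a0 P p0)
  fromFamily refl p0 = isContr-Quadruples c fe up _ p0
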